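{- Let $P_n$ be the path graph of order $n$. For every graph $G$ of minimum degree $\delta\ge 1$, $$\gamma_o(G\Box P_n)\ge \left\lceil\frac{(n-1)\gamma_o(G)}{2}\right\rceil+\left\lceil\frac{\delta}{2}\right\rceil.$$
   Context: All graphs are finite and simple. For a graph with vertex set $V$, a vertex $v$ and $S\subseteq V$, let $\delta_S(v)=|N(v)\cap S|$ and $\overline{S}=V\setminus S$. A nonempty set $S\subseteq V$ is a global offensive alliance if $\delta_S(v)\ge \delta_{\overline{S}}(v)+1$ for every $v\in\overline{S}$; $\gamma_o(G)$ is the minimum cardinality of a global offensive alliance of $G$. $G\Box H$ is the Cartesian product: vertex set $V(G)\times V(H)$, with $(a,b)\sim(c,d)$ iff ($a=c$ and $b\sim d$ in $H$) or ($a\sim c$ in $G$ and $b=d$). -}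

module Defs where

open import Data.Nat using (ℕ; zero; suc; _+_; _*_; _∸_; _≤_; ∣_-_∣; _≡ᵇ_)
open import Data.Bool using (Bool; true; false; _∧_; _∨_; not; if_then_else_)
open import Data.Fin using (Fin; toℕ; remQuot; _≟_)
open import Data.Product using (Σ; _×_; _,_; proj₁; proj₂)
open import Relation.Nullary.Decidable using (⌊_⌋)
open import Relation.Binary.PropositionalEquality using (_≡_)

countFin : ∀ {N} → (Fin N → Bool) → ℕ
countFin {zero}  f = 0
countFin {suc N} f = (if f Fin.zero then 1 else 0) + countFin (λ i → f (Fin.suc i))

record Graph : Set where
  field
    order  : ℕ
    adj    : Fin order → Fin order → Bool
    sym    : ∀ u v → adj u v ≡ adj v u
    irrefl : ∀ v → adj v v ≡ false
open Graph public

Adj : ℕ → Set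
Adj N = Fin N → Fin N → Bool

VSubset : ℕ → Set
VSubset N = Fin N → Bool

card : ∀ {N} → VSubset N → ℕ
card S = countFin S

compl : ∀ {N} → VSubset N → VSubset N
compl S v = not (S v)

deltaIn : ∀ {N} → Adj N → VSubset N → Fin N → ℕ
deltaIn a S v = countFin (λ u → a v u ∧ S u)

deg : ∀ {N} → Adj N → Fin N → ℕ
deg a v = countFin (a v)

-- global offensive alliance: S nonempty, and δ_S(v) ≥ δ_{S̄}(v) + 1 for all v ∉ S
IsGOA : ∀ {N} → Adj N → VSubset N → Set
IsGOA a S = (1 ≤ card S)
          × (∀ v → S v ≡ false → suc (deltaIn a (compl S) v) ≤ deltaIn a S v)

IsGammaO : ∀ {N} → Adj N → ℕ → Set
IsGammaO a k = Σ (VSubset _) (λ S → IsGOA a S × card S ≡ k)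
             × (∀ S → IsGOA a S → k ≤ card S)

IsMinDegree : Graph → ℕ → Set
IsMinDegree G d = (∀ v → d ≤ deg (adj G) v) × Σ (Fin (order G)) (λ v → deg (adj G) v ≡ d)

pathAdj : (n : ℕ) → Adj n
pathAdj n i j = ∣ toℕ i - toℕ j ∣ ≡ᵇ 1

-- Cartesian product G □ H on Fin (m * n), vertex combine a b ↔ (a , b)
boxAdj : ∀ {m n} → Adj m → Adj n → Adj (m * n)
boxAdj {m} {n} aG aH x y with remQuot {m} n x | remQuot {m} n y
... | (a , b) | (c , d) = (⌊ a ≟ c ⌋ ∧ aH b d) ∨ (aG a c ∧ ⌊ b ≟ d ⌋)

boxPath : (G : Graph) (n : ℕ) → Adj (order G * n)
boxPath G n = boxAdj {order G} {n} (adj G) (pathAdj n)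

-- Let S be a global offensive alliance of G □ Pₙ and Sᵢ ⊆ V(G) its i-th layer. A vertex
-- (u, i) ∉ S has at most two neighbours outside its layer, so when (u, i+1) ∉ S as well the
-- offensive inequality at (u, i) already holds inside layer i: Sᵢ ∪ Sᵢ₊₁ is a global offensive
-- alliance of G and |Sᵢ| + |Sᵢ₊₁| ≥ γₒ(G). At an end layer there is at most one such neighbour,
-- which forces 2|Sᵢ| ≥ δ. Adding the n − 1 consecutive pairs and the two end layers counts
-- every layer twice, so 2|S| ≥ (n − 1) γₒ(G) + 2⌈δ/2⌉.
module Submission where

open import Defs hiding (sym)
open import Data.Nat using (ℕ; zero; suc; _+_; _*_; _∸_; _≤_; z≤n; s≤s; ⌈_/2⌉; ∣_-_∣; _≡ᵇ_)
open import Data.Nat.Properties hiding (_≟_)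
open import Data.Nat.Tactic.RingSolver using (solve-∀)
open import Data.Bool using (Bool; true; false; _∧_; _∨_; not; if_then_else_; T)
open import Data.Bool.Properties
  using (T-∧; T-∨; T-not-≡; ∨-identityʳ; ∨-conicalˡ; ∨-conicalʳ; ∧-comm; ∧-assoc)
open import Data.Fin using (Fin; toℕ; combine; inject₁; fromℕ; _↑ˡ_; _↑ʳ_; _≟_)
open import Data.Fin.Properties using (remQuot-combine; toℕ-inject₁; toℕ-fromℕ; toℕ<n)
open import Data.Product using (Σ; _,_; proj₂; swap)
open import Data.Sum using (_⊎_; inj₁; inj₂)
open import Data.Unit using (tt)
open import Data.Empty using (⊥-elim)
open import Function using (_∘_)
open import Function.Bundles using (Equivalence)
open import Relation.Nullary using (Dec; yes; no)
open import Relation.Nullary.Decidable using (⌊_⌋)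
open import Relation.Binary.PropositionalEquality
open import Algebra.Properties.CommutativeMonoid.Sum +-0-commutativeMonoid
  using (sum; sum-syntax; ∑-distrib-+; ∑-comm; sum-cong-≗; sum-replicate-zero)

open Equivalence using (to; from)

indicator : Bool → ℕ
indicator b = if b then 1 else 0

countFin≡∑ : ∀ {N} (f : Fin N → Bool) → countFin f ≡ ∑[ i < N ] indicator (f i)
countFin≡∑ {zero}  f = refl
countFin≡∑ {suc N} f = cong (indicator (f Fin.zero) +_) (countFin≡∑ (f ∘ Fin.suc))

countFin-cong : ∀ {N} {f g : Fin N → Bool} → (∀ i → f i ≡ g i) → countFin f ≡ countFin g
countFin-cong {f = f} {g} f≗g =
  trans (countFin≡∑ f) (trans (sum-cong-≗ (cong indicator ∘ f≗g)) (sym (countFin≡∑ g)))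

countFin-mono : ∀ {N} (f g : Fin N → Bool) → (∀ i → T (f i) → T (g i)) → countFin f ≤ countFin g
countFin-mono {zero}  f g f⊆g = z≤n
countFin-mono {suc N} f g f⊆g with f Fin.zero | g Fin.zero | f⊆g Fin.zero
... | true  | true  | _    = s≤s (countFin-mono _ _ (f⊆g ∘ Fin.suc))
... | true  | false | f⊆g₀ = ⊥-elim (f⊆g₀ tt)
... | false | true  | _    = m≤n⇒m≤1+n (countFin-mono _ _ (f⊆g ∘ Fin.suc))
... | false | false | _    = countFin-mono _ _ (f⊆g ∘ Fin.suc)

countFin-∨ : ∀ {N} (f g : Fin N → Bool) → countFin (λ i → f i ∨ g i) ≤ countFin f + countFin g
countFin-∨ {zero}  f g = z≤n
countFin-∨ {suc N} f g with f Fin.zero | g Fin.zero | countFin-∨ (f ∘ Fin.suc) (g ∘ Fin.suc)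
... | true  | true  | ih = s≤s (≤-trans ih (≤-trans (m≤n+m _ 1) (≤-reflexive (sym (+-suc _ _)))))
... | true  | false | ih = s≤s ih
... | false | true  | ih = ≤-trans (s≤s ih) (≤-reflexive (sym (+-suc _ _)))
... | false | false | ih = ih

1≤countFin : ∀ {N} (f : Fin N → Bool) i → T (f i) → 1 ≤ countFin f
1≤countFin f Fin.zero    fi with f Fin.zero
... | true = s≤s z≤n
1≤countFin f (Fin.suc i) fi = ≤-trans (1≤countFin (f ∘ Fin.suc) i fi) (m≤n+m _ _)

countFin-∧-split : ∀ {N} (f g : Fin N → Bool) →
  countFin (λ i → f i ∧ g i) + countFin (λ i → f i ∧ not (g i)) ≡ countFin f
countFin-∧-split {zero}  f g = refl
countFin-∧-split {suc N} f g with f Fin.zero | g Fin.zero | countFin-∧-split (f ∘ Fin.suc) (g ∘ Fin.suc)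
... | true  | true  | ih = cong suc ih
... | true  | false | ih = trans (+-suc _ _) (cong suc ih)
... | false | _     | ih = ih

countFin-toℕ≡ᵇ : ∀ {N} x → countFin {N} (λ e → toℕ e ≡ᵇ x) ≤ 1
countFin-toℕ≡ᵇ {zero}  x       = z≤n
countFin-toℕ≡ᵇ {suc N} zero    = s≤s (≤-reflexive (countFin-false N))
  where
  countFin-false : ∀ N → countFin {N} (λ _ → false) ≡ 0
  countFin-false zero    = refl
  countFin-false (suc N) = countFin-false N
countFin-toℕ≡ᵇ {suc N} (suc x) = countFin-toℕ≡ᵇ {N} x

countFin-toℕ-≤1 : ∀ {N} (f : Fin N → Bool) x → (∀ e → T (f e) → toℕ e ≡ x) → countFin f ≤ 1
countFin-toℕ-≤1 {N} f x f⊆x =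
  ≤-trans (countFin-mono f (λ e → toℕ e ≡ᵇ x) (λ e → ≡⇒≡ᵇ _ _ ∘ f⊆x e)) (countFin-toℕ≡ᵇ {N} x)

countFin-toℕ-≤2 : ∀ {N} (f : Fin N → Bool) x y →
  (∀ e → T (f e) → toℕ e ≡ x ⊎ toℕ e ≡ y) → countFin f ≤ 2
countFin-toℕ-≤2 {N} f x y f⊆xy = begin
  countFin f                        ≤⟨ countFin-mono f _ f⊆ ⟩
  countFin (λ e → is x e ∨ is y e)  ≤⟨ countFin-∨ (is x) (is y) ⟩
  countFin (is x) + countFin (is y) ≤⟨ +-mono-≤ (countFin-toℕ≡ᵇ {N} x) (countFin-toℕ≡ᵇ {N} y) ⟩
  2                                 ∎
  where
  open ≤-Reasoning
  is : ℕ → Fin N → Bool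
  is z e = toℕ e ≡ᵇ z
  f⊆ : ∀ e → T (f e) → T (is x e ∨ is y e)
  f⊆ e fe with f⊆xy e fe
  ... | inj₁ e≡x = from T-∨ (inj₁ (≡⇒≡ᵇ _ _ e≡x))
  ... | inj₂ e≡y = from T-∨ (inj₂ (≡⇒≡ᵇ _ _ e≡y))

∑-if-≟ : ∀ {N} (u : Fin N) x → ∑[ c < N ] (if ⌊ u ≟ c ⌋ then x else 0) ≡ x
∑-if-≟ {suc N} Fin.zero    x = trans (cong (x +_) (sum-replicate-zero N)) (+-identityʳ x)
∑-if-≟ {suc N} (Fin.suc u) x = trans (sum-cong-≗ suc≟suc) (∑-if-≟ u x)
  where
  suc≟suc : ∀ c → (if ⌊ Fin.suc u ≟ Fin.suc c ⌋ then x else 0) ≡ (if ⌊ u ≟ c ⌋ then x else 0)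
  suc≟suc c with u ≟ c
  ... | yes _ = refl
  ... | no  _ = refl

countFin-≟-∧ : ∀ {N} (i : Fin N) (g : Fin N → Bool) → countFin (λ e → ⌊ i ≟ e ⌋ ∧ g e) ≡ indicator (g i)
countFin-≟-∧ i g =
  trans (countFin≡∑ (λ e → ⌊ i ≟ e ⌋ ∧ g e)) (trans (sum-cong-≗ only-at-i) (∑-if-≟ i (indicator (g i))))
  where
  only-at-i : ∀ e → indicator (⌊ i ≟ e ⌋ ∧ g e) ≡ (if ⌊ i ≟ e ⌋ then indicator (g i) else 0)
  only-at-i e with i ≟ e
  ... | yes refl = refl
  ... | no  _    = refl

all-or-missing : ∀ {N} (f : Fin N → Bool) → (∀ i → T (f i)) ⊎ Σ (Fin N) (λ i → f i ≡ false)
all-or-missing {zero}  f = inj₁ λ ()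
all-or-missing {suc N} f with f Fin.zero in f₀ | all-or-missing (f ∘ Fin.suc)
... | false | _              = inj₂ (Fin.zero , f₀)
... | true  | inj₂ (i , fᵢ) = inj₂ (Fin.suc i , fᵢ)
... | true  | inj₁ all      = inj₁ λ { Fin.zero → subst T (sym f₀) tt ; (Fin.suc i) → all i }

deltaIn+deltaIn-compl : ∀ {N} (a : Adj N) S v → deltaIn a S v + deltaIn a (compl S) v ≡ deg a v
deltaIn+deltaIn-compl a S v = countFin-∧-split (a v) S

offensive⇒nonempty : ∀ {N} (a : Adj N) S → Fin N →
  (∀ v → S v ≡ false → suc (deltaIn a (compl S) v) ≤ deltaIn a S v) → IsGOA a S
offensive⇒nonempty a S v offensive = nonempty , offensive
  where
  nonempty : 1 ≤ card S
  nonempty with S v in v∈?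
  ... | true  = 1≤countFin S v (subst T (sym v∈?) tt)
  ... | false = ≤-trans (s≤s z≤n) (≤-trans (offensive v v∈?)
                  (countFin-mono (λ c → a v c ∧ S c) S (λ c → proj₂ ∘ to T-∧)))

∣m-n∣≡1⇒ : ∀ m n → ∣ m - n ∣ ≡ 1 → n ≡ suc m ⊎ m ≡ suc n
∣m-n∣≡1⇒ m n eq with ≤-total m n
... | inj₁ m≤n = inj₁ (trans (sym (m∸n+n≡m m≤n)) (cong (_+ m) (trans (sym (m≤n⇒∣m-n∣≡n∸m m≤n)) eq)))
... | inj₂ n≤m = inj₂ (trans (sym (m∸n+n≡m n≤m)) (cong (_+ n) (trans (sym (m≤n⇒∣n-m∣≡n∸m n≤m)) eq)))

pathAdj-neighbour : ∀ {n} (i e : Fin n) → T (pathAdj n i e) → toℕ e ≡ suc (toℕ i) ⊎ toℕ i ≡ suc (toℕ e)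
pathAdj-neighbour i e ie = ∣m-n∣≡1⇒ (toℕ i) (toℕ e) (≡ᵇ⇒≡ _ 1 ie)

pathAdj-inject₁-suc : ∀ {n} (i : Fin n) → T (pathAdj (suc n) (inject₁ i) (Fin.suc i))
pathAdj-inject₁-suc i rewrite toℕ-inject₁ i =
  subst (λ j → T (∣ toℕ i - j ∣ ≡ᵇ 1)) (+-comm (toℕ i) 1) (≡⇒≡ᵇ _ 1 (∣m-m+n∣≡n (toℕ i) 1))

pathAdj-deg≤2 : ∀ n (i : Fin n) → deg (pathAdj n) i ≤ 2
pathAdj-deg≤2 n i = countFin-toℕ-≤2 (pathAdj n i) (suc (toℕ i)) (toℕ i ∸ 1) neighbours
  where
  neighbours : ∀ e → T (pathAdj n i e) → toℕ e ≡ suc (toℕ i) ⊎ toℕ e ≡ toℕ i ∸ 1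
  neighbours e ie with pathAdj-neighbour i e ie
  ... | inj₁ after  = inj₁ after
  ... | inj₂ before = inj₂ (cong (_∸ 1) (sym before))

pathAdj-deg-first≤1 : ∀ n → deg (pathAdj (suc n)) Fin.zero ≤ 1
pathAdj-deg-first≤1 n = countFin-toℕ-≤1 (pathAdj (suc n) Fin.zero) 1 neighbour
  where
  neighbour : ∀ e → T (pathAdj (suc n) Fin.zero e) → toℕ e ≡ 1
  neighbour e ie with pathAdj-neighbour Fin.zero e ie
  ... | inj₁ after = after

pathAdj-deg-last≤1 : ∀ n → deg (pathAdj (suc n)) (fromℕ n) ≤ 1
pathAdj-deg-last≤1 n = countFin-toℕ-≤1 (pathAdj (suc n) (fromℕ n)) (n ∸ 1) neighbour
  where
  neighbour : ∀ e → T (pathAdj (suc n) (fromℕ n) e) → toℕ e ≡ n ∸ 1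
  neighbour e ie with pathAdj-neighbour (fromℕ n) e ie
  ... | inj₁ after  = ⊥-elim (<⇒≱ (toℕ<n e) (≤-reflexive (trans (cong suc (sym (toℕ-fromℕ n))) (sym after))))
  ... | inj₂ before = cong (_∸ 1) (trans (sym before) (toℕ-fromℕ n))

layer : ∀ {m n} → VSubset (m * n) → Fin n → VSubset m
layer S i a = S (combine a i)

column : ∀ {m n} → VSubset (m * n) → Fin m → VSubset n
column S u e = S (combine u e)

countFin-↑ : ∀ k l (f : Fin (k + l) → Bool) → countFin f ≡ countFin (f ∘ (_↑ˡ l)) + countFin (f ∘ (k ↑ʳ_))
countFin-↑ zero    l f = refl
countFin-↑ (suc k) l f = trans (cong (f₀ +_) (countFin-↑ k l (f ∘ Fin.suc))) (sym (+-assoc f₀ _ _))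
  where f₀ = indicator (f Fin.zero)

countFin-combine : ∀ m n (f : Fin (m * n) → Bool) →
  countFin f ≡ ∑[ a < m ] countFin (λ (b : Fin n) → f (combine a b))
countFin-combine zero    n f = refl
countFin-combine (suc m) n f =
  trans (countFin-↑ n (m * n) f)
        (cong (countFin (λ (b : Fin n) → f (combine {suc m} Fin.zero b)) +_)
              (countFin-combine m n (f ∘ (_↑ʳ_ {m * n} n))))

card-layers : ∀ {m n} (S : VSubset (m * n)) → card S ≡ ∑[ i < n ] card (layer {m} S i)
card-layers {m} {n} S = begin
  card S
    ≡⟨ countFin-combine m n S ⟩
  ∑[ a < m ] countFin (column S a)
    ≡⟨ sum-cong-≗ (λ a → countFin≡∑ (column {m} S a)) ⟩
  ∑[ a < m ] ∑[ b < n ] indicator (S (combine a b))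
    ≡⟨ ∑-comm (λ (a : Fin m) (b : Fin n) → indicator (S (combine a b))) ⟩
  ∑[ b < n ] ∑[ a < m ] indicator (S (combine a b))
    ≡⟨ sum-cong-≗ (λ b → countFin≡∑ (layer {m} S b)) ⟨
  ∑[ b < n ] card (layer {m} S b)
    ∎
  where open ≡-Reasoning

boxAdj-combine : ∀ {m n} (aG : Adj m) (aH : Adj n) a b c d →
  boxAdj aG aH (combine a b) (combine c d) ≡ (⌊ a ≟ c ⌋ ∧ aH b d) ∨ (aG a c ∧ ⌊ b ≟ d ⌋)
boxAdj-combine {m} {n} aG aH a b c d
  rewrite cong swap (remQuot-combine {m} {n} a b) | cong swap (remQuot-combine {m} {n} c d) = refl

deltaIn-boxAdj : ∀ {m n} (aG : Adj m) (aH : Adj n) → (∀ v → aG v v ≡ false) → ∀ S u i →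
  deltaIn (boxAdj aG aH) S (combine u i) ≡ deltaIn aG (layer S i) u + deltaIn aH (column S u) i
deltaIn-boxAdj {m} {n} aG aH aG-irrefl S u i = begin
  deltaIn (boxAdj aG aH) S (combine u i)
    ≡⟨ countFin-combine m n _ ⟩
  ∑[ c < m ] countFin (λ e → boxAdj aG aH (combine u i) (combine c e) ∧ S (combine c e))
    ≡⟨ sum-cong-≗ column-count ⟩
  ∑[ c < m ] ((if ⌊ u ≟ c ⌋ then p else 0) + indicator (aG u c ∧ layer S i c))
    ≡⟨ ∑-distrib-+ (λ c → if ⌊ u ≟ c ⌋ then p else 0) (λ c → indicator (aG u c ∧ layer S i c)) ⟩
  ∑[ c < m ] (if ⌊ u ≟ c ⌋ then p else 0) + ∑[ c < m ] indicator (aG u c ∧ layer S i c)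
    ≡⟨ cong₂ _+_ (∑-if-≟ u p) (sym (countFin≡∑ (λ c → aG u c ∧ layer S i c))) ⟩
  p + deltaIn aG (layer S i) u
    ≡⟨ +-comm p _ ⟩
  deltaIn aG (layer S i) u + p
    ∎
  where
  open ≡-Reasoning
  p = deltaIn aH (column S u) i
  column-count : ∀ c → countFin (λ e → boxAdj aG aH (combine u i) (combine c e) ∧ S (combine c e))
                     ≡ (if ⌊ u ≟ c ⌋ then p else 0) + indicator (aG u c ∧ layer S i c)
  column-count c =
    trans (countFin-cong (λ e → cong (_∧ S (combine c e)) (boxAdj-combine aG aH u i c e))) (by-cases (u ≟ c))
    where
    by-cases : (u≟c : Dec (u ≡ c)) →
      countFin (λ e → ((⌊ u≟c ⌋ ∧ aH i e) ∨ (aG u c ∧ ⌊ i ≟ e ⌋)) ∧ S (combine c e))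
        ≡ (if ⌊ u≟c ⌋ then p else 0) + indicator (aG u c ∧ layer S i c)
    by-cases (yes refl) rewrite aG-irrefl u =
      trans (countFin-cong (λ e → cong (_∧ S (combine u e)) (∨-identityʳ (aH i e)))) (sym (+-identityʳ p))
    by-cases (no _) =
      trans (countFin-cong reassociate) (countFin-≟-∧ i (λ e → aG u c ∧ S (combine c e)))
      where
      reassociate : ∀ e → ((aG u c ∧ ⌊ i ≟ e ⌋) ∧ S (combine c e)) ≡ (⌊ i ≟ e ⌋ ∧ (aG u c ∧ S (combine c e)))
      reassociate e =
        trans (cong (_∧ S (combine c e)) (∧-comm (aG u c) ⌊ i ≟ e ⌋))
              (∧-assoc ⌊ i ≟ e ⌋ (aG u c) (S (combine c e)))

offensive-transfer : ∀ {x y p q} r → suc (x + q) ≤ y + p → p ≤ r + q → suc x ≤ r + y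
offensive-transfer {x} {y} {p} {q} r offensive p≤r+q = +-cancelʳ-≤ q (suc x) (r + y) (begin
  suc x + q    ≤⟨ offensive ⟩
  y + p        ≤⟨ +-monoʳ-≤ y p≤r+q ⟩
  y + (r + q)  ≡⟨ +-assoc y r q ⟨
  y + r + q    ≡⟨ cong (_+ q) (+-comm y r) ⟩
  r + y + q    ∎)
  where open ≤-Reasoning

m+n≤2⇒1≤n⇒m≤n : ∀ {m n} → m + n ≤ 2 → 1 ≤ n → m ≤ n
m+n≤2⇒1≤n⇒m≤n {m} m+n≤2 1≤n = ≤-trans (+-cancelʳ-≤ 1 m 1 (≤-trans (+-monoʳ-≤ m 1≤n) m+n≤2)) 1≤n

m≤n+n⇒⌈m/2⌉≤n : ∀ {m n} → m ≤ n + n → ⌈ m /2⌉ ≤ n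
m≤n+n⇒⌈m/2⌉≤n {m} {n} m≤n+n = ≤-trans (⌈n/2⌉-mono m≤n+n) (≤-reflexive (sym (n≡⌈n+n/2⌉ n)))

module _ (G : Graph) {n : ℕ} (aH : Adj n) (S : VSubset (order G * n))
         (S-goa : IsGOA (boxAdj (adj G) aH) S) where

  offensive-in-layer : ∀ u i r → layer S i u ≡ false →
    deltaIn aH (column S u) i ≤ r + deltaIn aH (compl (column S u)) i →
    suc (deltaIn (adj G) (compl (layer S i)) u) ≤ r + deltaIn (adj G) (layer S i) u
  offensive-in-layer u i r u∉Sᵢ = offensive-transfer r
    (subst₂ (λ x y → suc x ≤ y)
      (deltaIn-boxAdj (adj G) aH (irrefl G) (compl S) u i) (deltaIn-boxAdj (adj G) aH (irrefl G) S u i)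
      (proj₂ S-goa (combine u i) u∉Sᵢ))

  consecutive-layers-GOA : Fin (order G) → ∀ a b → deg aH a ≤ 2 → T (aH a b) →
    IsGOA (adj G) (λ x → layer S a x ∨ layer S b x)
  consecutive-layers-GOA v a b deg≤2 ab = offensive⇒nonempty (adj G) Sa∪Sb v offensive
    where
    Sa∪Sb : VSubset (order G)
    Sa∪Sb x = layer S a x ∨ layer S b x
    offensive : ∀ u → Sa∪Sb u ≡ false → suc (deltaIn (adj G) (compl Sa∪Sb) u) ≤ deltaIn (adj G) Sa∪Sb u
    offensive u u∉ = begin
      suc (deltaIn (adj G) (compl Sa∪Sb) u)        ≤⟨ s≤s (countFin-mono _ _ outside-Sa) ⟩
      suc (deltaIn (adj G) (compl (layer S a)) u)  ≤⟨ offensive-in-layer u a 0 u∉Sa p≤q ⟩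
      deltaIn (adj G) (layer S a) u                ≤⟨ countFin-mono _ _ inside-Sa ⟩
      deltaIn (adj G) Sa∪Sb u                      ∎
      where
      open ≤-Reasoning
      u∉Sa = ∨-conicalˡ (layer S a u) (layer S b u) u∉
      u∉Sb = ∨-conicalʳ (layer S a u) (layer S b u) u∉
      p = deltaIn aH (column S u) a
      q = deltaIn aH (compl (column S u)) a
      p≤q : p ≤ q
      p≤q = m+n≤2⇒1≤n⇒m≤n (≤-trans (≤-reflexive (deltaIn+deltaIn-compl aH (column S u) a)) deg≤2)
              (1≤countFin (λ e → aH a e ∧ not (column S u e)) b (from T-∧ (ab , from T-not-≡ u∉Sb)))
      outside-Sa : ∀ c → T (adj G u c ∧ not (Sa∪Sb c)) → T (adj G u c ∧ not (layer S a c))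
      outside-Sa c t with to (T-∧ {adj G u c}) t
      ... | uc , c∉ = from T-∧ (uc , from T-not-≡ (∨-conicalˡ _ (layer S b c) (to T-not-≡ c∉)))
      inside-Sa : ∀ c → T (adj G u c ∧ layer S a c) → T (adj G u c ∧ Sa∪Sb c)
      inside-Sa c t with to (T-∧ {adj G u c}) t
      ... | uc , c∈ = from (T-∧ {adj G u c}) (uc , from T-∨ (inj₁ c∈))

  end-layer-bound : ∀ {d} → (∀ v → d ≤ deg (adj G) v) → Fin (order G) → ∀ i → deg aH i ≤ 1 →
    ⌈ d /2⌉ ≤ card (layer {order G} S i)
  end-layer-bound {d} min-deg v i deg≤1 with all-or-missing (layer {order G} S i)
  ... | inj₁ full = begin
    ⌈ d /2⌉                     ≤⟨ ⌈n/2⌉≤n d ⟩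
    d                           ≤⟨ min-deg v ⟩
    deg (adj G) v               ≤⟨ countFin-mono (adj G v) (layer S i) (λ c _ → full c) ⟩
    card (layer {order G} S i)  ∎
    where open ≤-Reasoning
  ... | inj₂ (u , u∉Sᵢ) =
    ≤-trans (m≤n+n⇒⌈m/2⌉≤n d≤A+A) (countFin-mono _ (layer S i) (λ c → proj₂ ∘ to (T-∧ {adj G u c})))
    where
    A = deltaIn (adj G) (layer S i) u
    p≤1+q : deltaIn aH (column S u) i ≤ 1 + deltaIn aH (compl (column S u)) i
    p≤1+q = ≤-trans (m≤m+n _ _)
              (≤-trans (≤-reflexive (deltaIn+deltaIn-compl aH (column S u) i)) (≤-trans deg≤1 (s≤s z≤n)))
    d≤A+A : d ≤ A + A
    d≤A+A = ≤-trans (min-deg u)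
              (≤-trans (≤-reflexive (sym (deltaIn+deltaIn-compl (adj G) (layer S i) u)))
                       (+-monoʳ-≤ A (≤-pred (offensive-in-layer u i 1 u∉Sᵢ p≤1+q))))

pairs+ends≤2∑ : ∀ n k (L : Fin (suc n) → ℕ) → (∀ (i : Fin n) → k ≤ L (inject₁ i) + L (Fin.suc i)) →
  n * k + (L Fin.zero + L (fromℕ n)) ≤ sum L + sum L
pairs+ends≤2∑ zero    k L _ rewrite +-identityʳ (L Fin.zero) = ≤-refl
pairs+ends≤2∑ (suc n) k L pairs = begin
  (k + n * k) + (L₀ + Lₙ)         ≤⟨ +-monoˡ-≤ (L₀ + Lₙ) (+-monoˡ-≤ (n * k) (pairs Fin.zero)) ⟩
  (L₀ + L₁ + n * k) + (L₀ + Lₙ)   ≡⟨ regroup L₀ L₁ (n * k) Lₙ ⟩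
  (L₀ + L₀) + (n * k + (L₁ + Lₙ)) ≤⟨ +-monoʳ-≤ (L₀ + L₀) (pairs+ends≤2∑ n k (L ∘ Fin.suc) (pairs ∘ Fin.suc)) ⟩
  (L₀ + L₀) + (∑L′ + ∑L′)         ≡⟨ interleave L₀ ∑L′ ⟩
  (L₀ + ∑L′) + (L₀ + ∑L′)         ∎
  where
  open ≤-Reasoning
  L₀ = L Fin.zero
  L₁ = L (Fin.suc Fin.zero)
  Lₙ = L (fromℕ (suc n))
  ∑L′ = sum (L ∘ Fin.suc)
  regroup : ∀ a b x c → (a + b + x) + (a + c) ≡ (a + a) + (x + (b + c))
  regroup = solve-∀
  interleave : ∀ a s → (a + a) + (s + s) ≡ (a + s) + (a + s)
  interleave = solve-∀

⌈m+[n+n]/2⌉≡⌈m/2⌉+n : ∀ m n → ⌈ m + (n + n) /2⌉ ≡ ⌈ m /2⌉ + n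
⌈m+[n+n]/2⌉≡⌈m/2⌉+n m zero    = trans (cong ⌈_/2⌉ (+-identityʳ m)) (sym (+-identityʳ _))
⌈m+[n+n]/2⌉≡⌈m/2⌉+n m (suc n) = begin
  ⌈ m + (suc n + suc n) /2⌉     ≡⟨ cong ⌈_/2⌉ (trans (cong (m +_) (cong suc (+-suc n n))) (+-suc m _)) ⟩
  ⌈ suc (m + suc (n + n)) /2⌉   ≡⟨ cong (λ x → ⌈ suc x /2⌉) (+-suc m (n + n)) ⟩
  suc ⌈ m + (n + n) /2⌉         ≡⟨ cong suc (⌈m+[n+n]/2⌉≡⌈m/2⌉+n m n) ⟩
  suc (⌈ m /2⌉ + n)             ≡⟨ +-suc _ n ⟨
  ⌈ m /2⌉ + suc n               ∎
  where open ≡-Reasoning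

m+[n+n]≤o+o⇒⌈m/2⌉+n≤o : ∀ {m n o} → m + (n + n) ≤ o + o → ⌈ m /2⌉ + n ≤ o
m+[n+n]≤o+o⇒⌈m/2⌉+n≤o {m} {n} {o} bound = subst (_≤ o) (⌈m+[n+n]/2⌉≡⌈m/2⌉+n m n) (m≤n+n⇒⌈m/2⌉≤n bound)

theorem5 : (G : Graph) (n d k : ℕ) → IsMinDegree G d → 1 ≤ d → IsGammaO (adj G) k →
    ∀ g → IsGammaO (boxPath G n) g → ⌈ (n ∸ 1) * k /2⌉ + ⌈ d /2⌉ ≤ g
theorem5 G zero    d k _ _ _ g ((S , (S≢∅ , _) , _) , _) =
  ⊥-elim (1+n≰n (subst (1 ≤_) (card-layers {order G} {0} S) S≢∅))
theorem5 G (suc n) d k (min-deg , v , _) _ (_ , k-least) g ((S , S-goa , |S|≡g) , _) = begin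
  ⌈ n * k /2⌉ + ⌈ d /2⌉  ≤⟨ m+[n+n]≤o+o⇒⌈m/2⌉+n≤o {n * k} doubled ⟩
  sum L                  ≡⟨ card-layers {order G} S ⟨
  card S                 ≡⟨ |S|≡g ⟩
  g                      ∎
  where
  open ≤-Reasoning
  L : Fin (suc n) → ℕ
  L i = card (layer {order G} S i)
  end-layer : ∀ i → deg (pathAdj (suc n)) i ≤ 1 → ⌈ d /2⌉ ≤ L i
  end-layer = end-layer-bound G (pathAdj (suc n)) S S-goa min-deg v
  consecutive : ∀ i → k ≤ L (inject₁ i) + L (Fin.suc i)
  consecutive i =
    ≤-trans (k-least _ (consecutive-layers-GOA G (pathAdj (suc n)) S S-goa v (inject₁ i) (Fin.suc i)
                          (pathAdj-deg≤2 (suc n) (inject₁ i)) (pathAdj-inject₁-suc i)))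
            (countFin-∨ (layer {order G} S (inject₁ i)) (layer S (Fin.suc i)))
  doubled : n * k + (⌈ d /2⌉ + ⌈ d /2⌉) ≤ sum L + sum L
  doubled = ≤-trans (+-monoʳ-≤ (n * k) (+-mono-≤ (end-layer Fin.zero (pathAdj-deg-first≤1 n))
                                                  (end-layer (fromℕ n) (pathAdj-deg-last≤1 n))))
                    (pairs+ends≤2∑ n k L consecutive)
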